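{- Let $n$ be a positive integer and let $U(\mathbb{Z}_n)=\{\bar x\in\mathbb{Z}_n : \gcd(x,n)=1\}$ be the group of units of $\mathbb{Z}_n$. Then $OD(U(\mathbb{Z}_n))$ is the star graph $S_{\phi(n)}$ if and only if $n\mid 24$.
   Context: For a finite group $G$, the order divisor graph $OD(G)$ is the simple undirected graph with vertex set $G$ in which two distinct vertices $a,b$ are adjacent if and only if $o(a)\neq o(b)$ and either $o(a)\mid o(b)$ or $o(b)\mid o(a)$. $S_m$ denotes the star graph on $m$ vertices: a tree with one vertex of degree $m-1$ and all other vertices of degree $1$. $\phi$ is Euler's totient function. -}

module Defs where

open import Data.Nat using (ℕ; zero; suc; _+_; _^_; _≤_; _<_; NonZero)
open import Data.Nat.DivMod using (_%_)
open import Data.Nat.GCD using (gcd)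
open import Data.Nat.Divisibility using (_∣_)
open import Data.Fin using (Fin; toℕ)
open import Data.List using (List; length; filter)
open import Data.List.Base using (upTo)
open import Data.Product using (Σ; ∃; ∃₂; _×_; _,_)
open import Data.Sum using (_⊎_)
open import Relation.Nullary using (¬_)
open import Relation.Binary.PropositionalEquality using (_≡_; _≢_)
open import Function.Bundles using (_↔_; Inverse)
open import Data.Nat.Properties using (_≟_)

φ : ℕ → ℕ
φ n = length (filter (λ k → gcd (suc k) n ≟ 1) (upTo n))

U : ℕ → Set
U n = Σ (Fin n) (λ x → gcd (toℕ x) n ≡ 1)

IsOrder : (n : ℕ) → .{{_ : NonZero n}} → U n → ℕ → Set
IsOrder n (x , _) k =
  1 ≤ k × ((toℕ x ^ k) % n ≡ 1 % n)
        × (∀ j → 1 ≤ j → j < k → (toℕ x ^ j) % n ≢ 1 % n)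

record Graph : Set₁ where
  field
    V   : Set
    Adj : V → V → Set

OD : (n : ℕ) → .{{_ : NonZero n}} → Graph
OD n = record
  { V   = U n
  ; Adj = λ a b → a ≢ b × ∃₂ λ ka kb → IsOrder n a ka × IsOrder n b kb ×
                   ka ≢ kb × (ka ∣ kb ⊎ kb ∣ ka) }

Star : ℕ → Graph
Star m = record
  { V   = Fin m
  ; Adj = λ i j → i ≢ j × (toℕ i ≡ 0 ⊎ toℕ j ≡ 0) }

_≅_ : Graph → Graph → Set
G ≅ H = Σ (Graph.V G ↔ Graph.V H) λ f →
  ∀ u v → (Graph.Adj G u v → Graph.Adj H (Inverse.to f u) (Inverse.to f v))
        × (Graph.Adj H (Inverse.to f u) (Inverse.to f v) → Graph.Adj G u v)

-- A star has no triangle, whereas OD(U(ℤₙ)) has one as soon as some unit x has x² ≢ 1. If the order m of x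
-- is even, m = 2t, take 1, x^t, x (orders 1, 2, m); if m is odd, take 1, x, −x: the order of −x is a multiple
-- of m, since (−x)^k ≡ 1 forces x^(2k) ≡ 1, but not m itself, since (−x)^m ≡ −1. When n ∤ 24 such an x exists:
-- x = 5 if 5 ∤ n (as 5² − 1 = 24), and otherwise x = 1 + r⁴ where n = 5ᵃ r with 5 ∤ r, a unit with x ≡ 2
-- (mod 5) by Fermat. Conversely, for each of the eight divisors n of 24 every unit squares to 1, so 1 has
-- order 1 and every other unit order 2, and OD(U(ℤₙ)) is the star centred at 1; the bijection with
-- Fin (φ n) is given by a table checked by computation.

module Submission where

open import Defs
open import Data.Nat using (ℕ; zero; suc; _+_; _*_; _∸_; _^_; _≤_; _<_; z≤n; s≤s; NonZero; >-nonZero; >-nonZero⁻¹; _%_; _/_)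
open import Data.Nat.Properties
open import Data.Nat.DivMod using (_mod_; m%n<n; m%n%n≡m%n; m<n⇒m%n≡m; %-distribˡ-*; %-distribˡ-+; %-remove-+ʳ; m≡m%n+[m/n]*n; m∣n⇒o%n%m≡o%m)
open import Data.Nat.Divisibility
open import Data.Nat.GCD using (gcd)
open import Data.Nat.Coprimality as Coprime using (Coprime; coprime⇒gcd≡1; 1-coprimeTo; coprime-divisor)
open import Data.Nat.Primality using (Prime; prime?; prime[2]; prime⇒irreducible)
open import Data.Nat.Induction using (<-rec)
open import Data.Nat.Tactic.RingSolver using (solve-∀)
open import Algebra.Properties.CommutativeSemigroup *-commutativeSemigroup using (interchange)
open import Data.Fin as Fin using (Fin; toℕ; fromℕ<; #_)
open import Data.Fin.Properties using (toℕ-fromℕ<; toℕ-injective; toℕ<n; pigeonhole; any?; all?)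
open import Data.Vec using (Vec; lookup; _∷_; [])
open import Data.List using (List; _∷_; [])
open import Data.List.Membership.Propositional using (_∈_)
open import Data.List.Membership.DecPropositional _≟_ using (_∈?_)
open import Data.List.Relation.Unary.All as All using (All; _∷_; [])
open import Data.Product using (∃; ∃₂; _×_; _,_; proj₁; proj₂)
open import Data.Product.Properties using (Σ-≡,≡→≡)
open import Data.Sum using (_⊎_; inj₁; inj₂; swap)
open import Function using (_∘_)
open import Function.Bundles using (_↔_; Inverse; _⇔_; Equivalence; mk⇔; mk↔ₛ′)
open import Relation.Nullary using (¬_; Dec; yes; no; contradiction)
open import Relation.Nullary.Decidable using (_×-dec_; _→-dec_; from-yes; True; toWitness)
open import Relation.Unary using (Pred; Decidable)
open import Relation.Binary.PropositionalEquality

^-distribʳ-* : ∀ m n o → (m * n) ^ o ≡ m ^ o * n ^ o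
^-distribʳ-* m n zero    = refl
^-distribʳ-* m n (suc o) = begin
  m * n * (m * n) ^ o      ≡⟨ cong (m * n *_) (^-distribʳ-* m n o) ⟩
  m * n * (m ^ o * n ^ o)  ≡⟨ interchange m n (m ^ o) (n ^ o) ⟩
  m * m ^ o * (n * n ^ o)  ∎
  where open ≡-Reasoning

coprime-* : ∀ {a b c} → Coprime a c → Coprime b c → Coprime (a * b) c
coprime-* {a} a⊥c b⊥c {d} (d∣ab , d∣c) = b⊥c (coprime-divisor d⊥a d∣ab , d∣c)
  where
  d⊥a : Coprime d a
  d⊥a (e∣d , e∣a) = a⊥c (e∣a , ∣-trans e∣d d∣c)

coprime-^ : ∀ {a c} → Coprime a c → ∀ k → Coprime (a ^ k) c
coprime-^ {c = c} a⊥c zero    = 1-coprimeTo c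
coprime-^         a⊥c (suc k) = coprime-* a⊥c (coprime-^ a⊥c k)

prime∤⇒coprime : ∀ {p m} → Prime p → ¬ p ∣ m → Coprime p m
prime∤⇒coprime p-prime p∤m (d∣p , d∣m) with prime⇒irreducible p-prime d∣p
... | inj₁ d≡1    = d≡1
... | inj₂ refl   = contradiction d∣m p∤m

factor-out : ∀ p → 1 < p → ∀ m → 1 ≤ m → ∃₂ λ a r → m ≡ p ^ a * r × ¬ p ∣ r
factor-out p 1<p = <-rec (λ m → 1 ≤ m → ∃₂ λ a r → m ≡ p ^ a * r × ¬ p ∣ r) split
  where
  split : ∀ m → (∀ {q} → q < m → 1 ≤ q → ∃₂ λ a r → q ≡ p ^ a * r × ¬ p ∣ r) →
          1 ≤ m → ∃₂ λ a r → m ≡ p ^ a * r × ¬ p ∣ r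
  split m smaller 1≤m with p ∣? m
  ... | no p∤m = 0 , m , sym (*-identityˡ m) , p∤m
  ... | yes (divides zero refl) = contradiction 1≤m λ ()
  ... | yes (divides q@(suc _) refl) with smaller (m<m*n q p 1<p) (s≤s z≤n)
  ...   | a , r , q≡pᵃr , p∤r = suc a , r , (begin
          q * p            ≡⟨ cong (_* p) q≡pᵃr ⟩
          p ^ a * r * p    ≡⟨ *-comm (p ^ a * r) p ⟩
          p * (p ^ a * r)  ≡⟨ *-assoc p (p ^ a) r ⟨
          p ^ suc a * r    ∎) , p∤r
    where open ≡-Reasoning

MinimalPositive : (ℕ → Set) → ℕ → Set
MinimalPositive P k = 1 ≤ k × P k × (∀ j → 1 ≤ j → j < k → ¬ P j)

minimalPositive : ∀ {P : Pred ℕ _} → Decidable P → ∀ K → 1 ≤ K → P K → ∃ (MinimalPositive P)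
minimalPositive {P} P? = <-rec (λ K → 1 ≤ K → P K → ∃ (MinimalPositive P)) search
  where
  search : ∀ K → (∀ {j} → j < K → 1 ≤ j → P j → ∃ (MinimalPositive P)) → 1 ≤ K → P K → ∃ (MinimalPositive P)
  search K smaller 1≤K PK with any? (λ (i : Fin K) → 1 ≤? toℕ i ×-dec P? (toℕ i))
  ... | yes (i , 1≤i , Pi) = smaller (toℕ<n i) 1≤i Pi
  ... | no ∄ = K , 1≤K , PK , λ j 1≤j j<K Pj →
    ∄ (fromℕ< j<K , subst (λ t → 1 ≤ t × P t) (sym (toℕ-fromℕ< j<K)) (1≤j , Pj))

module Modulo (n : ℕ) .{{_ : NonZero n}} where

  infix 4 _≈_
  _≈_ : ℕ → ℕ → Set
  a ≈ b = a % n ≡ b % n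

  %-≈ : ∀ a → a % n ≈ a
  %-≈ a = m%n%n≡m%n a n

  *-cong-≈ : ∀ {a b c d} → a ≈ b → c ≈ d → a * c ≈ b * d
  *-cong-≈ {a} {b} {c} {d} a≈b c≈d = begin
    a * c % n              ≡⟨ %-distribˡ-* a c n ⟩
    (a % n) * (c % n) % n  ≡⟨ cong₂ (λ x y → x * y % n) a≈b c≈d ⟩
    (b % n) * (d % n) % n  ≡⟨ %-distribˡ-* b d n ⟨
    b * d % n              ∎
    where open ≡-Reasoning

  ^-cong-≈ : ∀ {a b} → a ≈ b → ∀ k → a ^ k ≈ b ^ k
  ^-cong-≈ a≈b zero    = refl
  ^-cong-≈ a≈b (suc k) = *-cong-≈ a≈b (^-cong-≈ a≈b k)

  ≈1⇒*-identityˡ : ∀ {a b} → a ≈ 1 → a * b ≈ b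
  ≈1⇒*-identityˡ {a} {b} a≈1 = trans (*-cong-≈ a≈1 (refl {x = b % n})) (cong (_% n) (*-identityˡ b))

  ≈1⇒*-identityʳ : ∀ {a b} → b ≈ 1 → a * b ≈ a
  ≈1⇒*-identityʳ {a} {b} b≈1 = trans (cong (_% n) (*-comm a b)) (≈1⇒*-identityˡ b≈1)

  ≈⇒∣∸ : ∀ {a b} → a ≈ b → n ∣ b ∸ a
  ≈⇒∣∸ {a} {b} a≈b = divides (b / n ∸ a / n) (begin
    b ∸ a                                      ≡⟨ cong₂ _∸_ (m≡m%n+[m/n]*n b n) (m≡m%n+[m/n]*n a n) ⟩
    (b % n + b / n * n) ∸ (a % n + a / n * n)  ≡⟨ cong (λ r → (b % n + b / n * n) ∸ (r + a / n * n)) a≈b ⟩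
    (b % n + b / n * n) ∸ (b % n + a / n * n)  ≡⟨ [m+n]∸[m+o]≡n∸o (b % n) _ _ ⟩
    b / n * n ∸ a / n * n                      ≡⟨ *-distribʳ-∸ n (b / n) (a / n) ⟨
    (b / n ∸ a / n) * n                        ∎)
    where open ≡-Reasoning

  ∣∸⇒≈ : ∀ {a b} → a ≤ b → n ∣ b ∸ a → a ≈ b
  ∣∸⇒≈ {a} {b} a≤b n∣b∸a = sym (begin
    b % n            ≡⟨ cong (_% n) (m+[n∸m]≡n a≤b) ⟨
    (a + (b ∸ a)) % n ≡⟨ %-remove-+ʳ a n∣b∸a ⟩
    a % n            ∎)
    where open ≡-Reasoning

  *-cancelˡ-≈ : ∀ {c a b} → Coprime c n → c * a ≈ c * b → a ≈ b
  *-cancelˡ-≈ {c} {a} {b} c⊥n ca≈cb with ≤-total a b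
  ... | inj₁ a≤b = ∣∸⇒≈ a≤b (coprime-divisor (Coprime.sym c⊥n)
                     (subst (n ∣_) (sym (*-distribˡ-∸ c b a)) (≈⇒∣∸ ca≈cb)))
  ... | inj₂ b≤a = sym (∣∸⇒≈ b≤a (coprime-divisor (Coprime.sym c⊥n)
                     (subst (n ∣_) (sym (*-distribˡ-∸ c a b)) (≈⇒∣∸ (sym ca≈cb)))))

  -- IsOrder n u k unfolds to Order (toℕ (proj₁ u)) k.
  Order : ℕ → ℕ → Set
  Order a = MinimalPositive (λ j → a ^ j ≈ 1)

  Order-resp-≈ : ∀ {a b k} → a ≈ b → Order a k → Order b k
  Order-resp-≈ {k = k} a≈b (1≤k , aᵏ≈1 , minimal) =
    1≤k , trans (sym (^-cong-≈ a≈b k)) aᵏ≈1 , λ j 1≤j j<k bʲ≈1 → minimal j 1≤j j<k (trans (^-cong-≈ a≈b j) bʲ≈1)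

  ^-multiple-≈1 : ∀ {a k j} → a ^ k ≈ 1 → k ∣ j → a ^ j ≈ 1
  ^-multiple-≈1 {a} {k} aᵏ≈1 (divides q refl) = begin
    a ^ (q * k) % n    ≡⟨ cong (λ e → a ^ e % n) (*-comm q k) ⟩
    a ^ (k * q) % n    ≡⟨ cong (_% n) (^-*-assoc a k q) ⟨
    (a ^ k) ^ q % n    ≡⟨ ^-cong-≈ aᵏ≈1 q ⟩
    1 ^ q % n          ≡⟨ cong (_% n) (^-zeroˡ q) ⟩
    1 % n              ∎
    where open ≡-Reasoning

  order∣ : ∀ {a k j} → Order a k → a ^ j ≈ 1 → k ∣ j
  order∣ {a} {k} {j} (1≤k , aᵏ≈1 , minimal) aʲ≈1 = m%n≡0⇒n∣m j k remainder≡0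
    where
    instance
      k≢0 : NonZero k
      k≢0 = >-nonZero 1≤k
    aʳ≈1 : a ^ (j % k) ≈ 1
    aʳ≈1 = begin
      a ^ (j % k) % n                           ≡⟨ cong (_% n) (*-identityʳ (a ^ (j % k))) ⟨
      a ^ (j % k) * 1 % n                       ≡⟨ *-cong-≈ {a ^ (j % k)} refl (^-multiple-≈1 aᵏ≈1 (n∣m*n (j / k))) ⟨
      a ^ (j % k) * a ^ (j / k * k) % n         ≡⟨ cong (_% n) (^-distribˡ-+-* a (j % k) (j / k * k)) ⟨
      a ^ (j % k + j / k * k) % n               ≡⟨ cong (λ e → a ^ e % n) (m≡m%n+[m/n]*n j k) ⟨
      a ^ j % n                                 ≡⟨ aʲ≈1 ⟩
      1 % n                                     ∎
      where open ≡-Reasoning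
    remainder≡0 : j % k ≡ 0
    remainder≡0 with j % k | aʳ≈1 | m%n<n j k
    ... | zero  | _    | _   = refl
    ... | suc r | aʳ≈1 | r<k = contradiction aʳ≈1 (minimal (suc r) (s≤s z≤n) r<k)

  order-unique : ∀ {a k l} → Order a k → Order a l → k ≡ l
  order-unique o₁@(_ , aᵏ≈1 , _) o₂@(_ , aˡ≈1 , _) = ∣-antisym (order∣ o₁ aˡ≈1) (order∣ o₂ aᵏ≈1)

  -- The residues of a⁰, …, aⁿ collide, and a common factor aⁱ cancels since it is a unit.
  order-exists : ∀ {a} → Coprime a n → ∃ (Order a)
  order-exists {a} a⊥n with pigeonhole (n<1+n n) (λ i → (a ^ toℕ i) mod n)
  ... | i , j , i<j , residues≡ =
    minimalPositive (λ e → a ^ e % n ≟ 1 % n) (toℕ j ∸ toℕ i) (m<n⇒0<n∸m i<j) (sym 1≈aᵈ)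
    where
    aⁱ≈aʲ : a ^ toℕ i ≈ a ^ toℕ j
    aⁱ≈aʲ = trans (sym (toℕ-fromℕ< (m%n<n (a ^ toℕ i) n)))
              (trans (cong toℕ residues≡) (toℕ-fromℕ< (m%n<n (a ^ toℕ j) n)))
    1≈aᵈ : 1 ≈ a ^ (toℕ j ∸ toℕ i)
    1≈aᵈ = *-cancelˡ-≈ (coprime-^ a⊥n (toℕ i)) (begin
      a ^ toℕ i * 1 % n                       ≡⟨ cong (_% n) (*-identityʳ (a ^ toℕ i)) ⟩
      a ^ toℕ i % n                           ≡⟨ aⁱ≈aʲ ⟩
      a ^ toℕ j % n                           ≡⟨ cong (λ e → a ^ e % n) (m+[n∸m]≡n (<⇒≤ i<j)) ⟨
      a ^ (toℕ i + (toℕ j ∸ toℕ i)) % n       ≡⟨ cong (_% n) (^-distribˡ-+-* a (toℕ i) _) ⟩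
      a ^ toℕ i * a ^ (toℕ j ∸ toℕ i) % n     ∎)
      where open ≡-Reasoning

  order-1 : Order 1 1
  order-1 = s≤s z≤n , refl , λ { zero () _ ; (suc j) _ (s≤s ()) }

  order-2 : ∀ {a} → a ^ 2 ≈ 1 → ¬ a ≈ 1 → Order a 2
  order-2 {a} a²≈1 a≉1 = s≤s z≤n , a²≈1 , λ
    { zero () _
    ; (suc zero) _ _ a¹≈1 → a≉1 (trans (cong (_% n) (sym (*-identityʳ a))) a¹≈1)
    ; (suc (suc j)) _ (s≤s (s≤s ())) }

≈-mod-divisor : ∀ {d m a b} .{{_ : NonZero d}} .{{_ : NonZero m}} → d ∣ m →
                Modulo._≈_ m a b → Modulo._≈_ d a b
≈-mod-divisor {d} {m} {a} {b} d∣m a≈b =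
  trans (sym (m∣n⇒o%n%m≡o%m d m a d∣m)) (trans (cong (_% d) a≈b) (m∣n⇒o%n%m≡o%m d m b d∣m))

pred-coprime : ∀ {m} → 0 < m → Coprime (m ∸ 1) m
pred-coprime {suc s} _ {d} (d∣s , d∣1+s) = ∣1⇒≡1 (∣m+n∣m⇒∣n (subst (d ∣_) (+-comm 1 s) d∣1+s) d∣s)

pred²≈1 : ∀ m .{{_ : NonZero m}} → Modulo._≈_ m ((m ∸ 1) ^ 2) 1
pred²≈1 (suc zero)    = refl
pred²≈1 m@(suc (suc s)) = begin
  suc s ^ 2 % m          ≡⟨ cong (_% m) (square≡ s) ⟩
  (1 + s * m) % m        ≡⟨ %-remove-+ʳ 1 (n∣m*n s) ⟩
  1 % m                  ∎
  where
  open ≡-Reasoning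
  square≡ : ∀ s → (1 + s) * ((1 + s) * 1) ≡ 1 + s * (2 + s)
  square≡ = solve-∀

pred≉1 : ∀ m .{{_ : NonZero m}} → 2 < m → ¬ Modulo._≈_ m (m ∸ 1) 1
pred≉1 (suc zero) (s≤s ())
pred≉1 (suc (suc zero)) (s≤s (s≤s ()))
pred≉1 (suc (suc (suc s))) _ pred≈1 = contradiction (trans (sym (m<n⇒m%n≡m (n<1+n (2 + s)))) pred≈1) λ ()

Triangle : Graph → Set
Triangle G = ∃₂ λ a b → ∃ λ c → Adj a b × Adj b c × Adj a c
  where open Graph G

Star-triangle-free : ∀ {m} → ¬ Triangle (Star m)
Star-triangle-free (a , b , c , (a≢b , a∨b) , (b≢c , b∨c) , (a≢c , a∨c)) with a∨b | b∨c | a∨c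
... | inj₁ a₀ | inj₁ b₀ | _      = a≢b (toℕ-injective (trans a₀ (sym b₀)))
... | inj₁ a₀ | inj₂ c₀ | _      = a≢c (toℕ-injective (trans a₀ (sym c₀)))
... | inj₂ b₀ | _      | inj₁ a₀ = a≢b (toℕ-injective (trans a₀ (sym b₀)))
... | inj₂ b₀ | _      | inj₂ c₀ = b≢c (toℕ-injective (trans b₀ (sym c₀)))

triangle⇒≇Star : ∀ {G m} → Triangle G → ¬ (G ≅ Star m)
triangle⇒≇Star (a , b , c , ab , bc , ac) (f , preserves) =
  Star-triangle-free (_ , _ , _ , proj₁ (preserves a b) ab , proj₁ (preserves b c) bc , proj₁ (preserves a c) ac)

module Units (n : ℕ) .{{_ : NonZero n}} where
  open Modulo n public

  coprime-% : ∀ {a} → Coprime a n → Coprime (a % n) n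
  coprime-% {a} a⊥n (d∣a%n , d∣n) = a⊥n (∣n∣m%n⇒∣m d∣n d∣a%n , d∣n)

  unit : ∀ a → Coprime a n → U n
  unit a a⊥n = a mod n , coprime⇒gcd≡1 (subst (λ r → Coprime r n) (sym (toℕ-fromℕ< (m%n<n a n))) (coprime-% a⊥n))

  unit-IsOrder : ∀ {a k} (a⊥n : Coprime a n) → Order a k → IsOrder n (unit a a⊥n) k
  unit-IsOrder {a} _ = Order-resp-≈ (sym (trans (cong (_% n) (toℕ-fromℕ< (m%n<n a n))) (%-≈ a)))

  one : U n
  one = unit 1 (1-coprimeTo n)

  one-IsOrder : IsOrder n one 1
  one-IsOrder = unit-IsOrder (1-coprimeTo n) order-1

  OD-adjacent : ∀ {u v k l} → IsOrder n u k → IsOrder n v l → k ≢ l → k ∣ l → Graph.Adj (OD n) u v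
  OD-adjacent {k = k} {l} oᵤ oᵥ k≢l k∣l =
    (λ { refl → k≢l (order-unique oᵤ oᵥ) }) , k , l , oᵤ , oᵥ , k≢l , inj₁ k∣l

  OD-sym : ∀ {u v} → Graph.Adj (OD n) u v → Graph.Adj (OD n) v u
  OD-sym (u≢v , k , l , oᵤ , oᵥ , k≢l , k∣l⊎l∣k) = u≢v ∘ sym , l , k , oᵥ , oᵤ , k≢l ∘ sym , swap k∣l⊎l∣k

module Triangles (n : ℕ) .{{_ : NonZero n}} (2<n : 2 < n) where
  open Units n

  minus-one : ℕ
  minus-one = n ∸ 1

  minus-one⊥n : Coprime minus-one n
  minus-one⊥n = pred-coprime (≤-trans (s≤s z≤n) 2<n)

  minus-one-order : Order minus-one 2
  minus-one-order = order-2 (pred²≈1 n) (pred≉1 n 2<n)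

  even-order-triangle : ∀ {x m} → Coprime x n → Order x m → ¬ m ∣ 2 → 2 ∣ m → Triangle (OD n)
  even-order-triangle _ (1≤m , _) _ (divides zero refl) = contradiction 1≤m λ ()
  even-order-triangle {x} {m} x⊥n oₓ@(_ , xᵐ≈1 , minimal) m∤2 2∣m@(divides t@(suc _) m≡t*2) =
    one , unit y y⊥n , unit x x⊥n ,
    OD-adjacent one-IsOrder oᵧ (λ ()) (1∣ 2) ,
    OD-adjacent oᵧ (unit-IsOrder x⊥n oₓ) (λ { refl → m∤2 ∣-refl }) 2∣m ,
    OD-adjacent one-IsOrder (unit-IsOrder x⊥n oₓ) (λ { refl → m∤2 (1∣ 2) }) (1∣ m)
    where
    y = x ^ t
    y⊥n = coprime-^ x⊥n t
    y²≈1 : y ^ 2 ≈ 1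
    y²≈1 = trans (cong (_% n) (trans (^-*-assoc x t 2) (cong (x ^_) (sym m≡t*2)))) xᵐ≈1
    y≉1 : ¬ y ≈ 1
    y≉1 y≈1 = minimal t (s≤s z≤n) (subst (t <_) (sym m≡t*2) (m<m*n t 2 ≤-refl)) y≈1
    oᵧ : IsOrder n (unit y y⊥n) 2
    oᵧ = unit-IsOrder y⊥n (order-2 y²≈1 y≉1)

  odd-order-triangle : ∀ {x m} → Coprime x n → Order x m → ¬ m ∣ 2 → ¬ 2 ∣ m → Triangle (OD n)
  odd-order-triangle {x} {m} x⊥n oₓ@(_ , xᵐ≈1 , _) m∤2 2∤m with order-exists (coprime-* minus-one⊥n x⊥n)
  ... | k , o₋ₓ@(_ , [-x]ᵏ≈1 , _) =
    one , unit x x⊥n , unit (minus-one * x) -x⊥n ,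
    OD-adjacent one-IsOrder (unit-IsOrder x⊥n oₓ) (λ { refl → m∤2 (1∣ 2) }) (1∣ m) ,
    OD-adjacent (unit-IsOrder x⊥n oₓ) (unit-IsOrder -x⊥n o₋ₓ) m≢k m∣k ,
    OD-adjacent one-IsOrder (unit-IsOrder -x⊥n o₋ₓ) 1≢k (1∣ k)
    where
    w = minus-one
    -x⊥n = coprime-* minus-one⊥n x⊥n
    w²≈1 : w ^ 2 ≈ 1
    w²≈1 = proj₁ (proj₂ minus-one-order)
    m∣k : m ∣ k
    m∣k = coprime-divisor (Coprime.sym (prime∤⇒coprime prime[2] 2∤m)) (order∣ oₓ x²ᵏ≈1)
      where
      open ≡-Reasoning
      x²ᵏ≈1 : x ^ (2 * k) ≈ 1
      x²ᵏ≈1 = begin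
        x ^ (2 * k) % n                ≡⟨ ≈1⇒*-identityˡ (^-multiple-≈1 {w} {2} w²≈1 (m∣m*n k)) ⟨
        w ^ (2 * k) * x ^ (2 * k) % n  ≡⟨ cong (_% n) (^-distribʳ-* w x (2 * k)) ⟨
        (w * x) ^ (2 * k) % n          ≡⟨ ^-multiple-≈1 {w * x} {k} [-x]ᵏ≈1 (n∣m*n 2) ⟩
        1 % n                          ∎
    m≢k : m ≢ k
    m≢k refl = 2∤m (order∣ minus-one-order wᵐ≈1)
      where
      wᵐ≈1 : w ^ m ≈ 1
      wᵐ≈1 = trans (sym (≈1⇒*-identityʳ xᵐ≈1)) (trans (cong (_% n) (sym (^-distribʳ-* w x m))) [-x]ᵏ≈1)
    1≢k : 1 ≢ k
    1≢k refl = m∤2 (∣-trans m∣k (1∣ 2))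

  square≉1⇒triangle : ∀ {x} → Coprime x n → ¬ x ^ 2 ≈ 1 → Triangle (OD n)
  square≉1⇒triangle {x} x⊥n x²≉1 with order-exists x⊥n
  ... | m , oₓ = by-parity (2 ∣? m)
    where
    m∤2 : ¬ m ∣ 2
    m∤2 m∣2 = x²≉1 (^-multiple-≈1 (proj₁ (proj₂ oₓ)) m∣2)
    by-parity : Dec (2 ∣ m) → Triangle (OD n)
    by-parity (yes 2∣m) = even-order-triangle x⊥n oₓ m∤2 2∣m
    by-parity (no 2∤m)  = odd-order-triangle x⊥n oₓ m∤2 2∤m

prime[5] : Prime 5
prime[5] = from-yes (prime? 5)

fermat-5 : ∀ {r} → ¬ 5 ∣ r → r ^ 4 % 5 ≡ 1
fermat-5 {r} 5∤r = trans (sym (Modulo.^-cong-≈ 5 {r % 5} {r} (Modulo.%-≈ 5 r) 4))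
                     (residue (r % 5) (m%n<n r 5) (5∤r ∘ m%n≡0⇒n∣m r 5))
  where
  residue : ∀ s → s < 5 → s ≢ 0 → s ^ 4 % 5 ≡ 1
  residue 0 _ s≢0 = contradiction refl s≢0
  residue 1 _ _ = refl
  residue 2 _ _ = refl
  residue 3 _ _ = refl
  residue 4 _ _ = refl
  residue (suc (suc (suc (suc (suc _))))) (s≤s (s≤s (s≤s (s≤s (s≤s ()))))) _

¬∣24⇒square≉1 : ∀ {n} .{{_ : NonZero n}} → ¬ n ∣ 24 → ∃ λ x → Coprime x n × ¬ Modulo._≈_ n (x ^ 2) 1
¬∣24⇒square≉1 {n} n∤24 with 5 ∣? n
... | no 5∤n = 5 , prime∤⇒coprime prime[5] 5∤n , λ 25≈1 → n∤24 (Modulo.≈⇒∣∸ n (sym 25≈1))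
... | yes 5∣n with factor-out 5 (s≤s (s≤s z≤n)) n (>-nonZero⁻¹ n)
...   | a , r , n≡5ᵃr , 5∤r = x , Coprime.sym n⊥x , x²≉1
  where
  x = 1 + r ^ 4
  x%5≡2 : x % 5 ≡ 2
  x%5≡2 = trans (%-distribˡ-+ 1 (r ^ 4) 5) (cong (λ e → (1 + e) % 5) (fermat-5 5∤r))
  5∤x : ¬ 5 ∣ x
  5∤x 5∣x = contradiction (trans (sym x%5≡2) (n∣m⇒m%n≡0 x 5 5∣x)) λ ()
  r⊥x : Coprime r x
  r⊥x {d} (d∣r , d∣x) = ∣1⇒≡1 (∣m+n∣m⇒∣n (subst (d ∣_) (+-comm 1 (r ^ 4)) d∣x) (∣-trans d∣r (m∣m*n (r ^ 3))))
  n⊥x : Coprime n x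
  n⊥x = subst (λ m → Coprime m x) (sym n≡5ᵃr) (coprime-* (coprime-^ (prime∤⇒coprime prime[5] 5∤x) a) r⊥x)
  x²≉1 : ¬ Modulo._≈_ n (x ^ 2) 1
  x²≉1 x²≈1 = contradiction (begin
    4                  ≡⟨ cong (λ e → e ^ 2 % 5) x%5≡2 ⟨
    (x % 5) ^ 2 % 5    ≡⟨ Modulo.^-cong-≈ 5 {x % 5} {x} (Modulo.%-≈ 5 x) 2 ⟩
    x ^ 2 % 5          ≡⟨ ≈-mod-divisor 5∣n x²≈1 ⟩
    1                  ∎) λ ()
    where open ≡-Reasoning

module StarCriterion (n : ℕ) .{{_ : NonZero n}} where
  open Units n

  IsIdentity : U n → Set
  IsIdentity (x , _) = toℕ x ≡ 1 % n

  identity-unique : ∀ {u v} → IsIdentity u → IsIdentity v → u ≡ v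
  identity-unique {x , _} {y , _} x≡1 y≡1 =
    Σ-≡,≡→≡ (toℕ-injective (trans x≡1 (sym y≡1)) , ≡-irrelevant _ _)

  identity-IsOrder : ∀ u → IsIdentity u → IsOrder n u 1
  identity-IsOrder (x , _) x≡1 = Order-resp-≈ (sym (trans (cong (_% n) x≡1) (%-≈ 1))) order-1

  module _ (square≈1 : ∀ (u : U n) → toℕ (proj₁ u) ^ 2 ≈ 1) where

    non-identity-IsOrder : ∀ u → ¬ IsIdentity u → IsOrder n u 2
    non-identity-IsOrder u@(x , _) x≢1 =
      order-2 (square≈1 u) λ x≈1 → x≢1 (trans (sym (m<n⇒m%n≡m (toℕ<n x))) x≈1)

    star-criterion : ∀ {m} (e : U n ↔ Fin m) → (∀ u → toℕ (Inverse.to e u) ≡ 0 ⇔ IsIdentity u) → OD n ≅ Star m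
    star-criterion e centre = e , λ u v → OD⇒Star u v , Star⇒OD u v
      where
      open Inverse e
      isIdentity? : ∀ u → Dec (IsIdentity u)
      isIdentity? (x , _) = toℕ x ≟ 1 % n
      OD⇒Star : ∀ u v → Graph.Adj (OD n) u v → Graph.Adj (Star _) (to u) (to v)
      OD⇒Star u v (u≢v , k , l , oᵤ , oᵥ , k≢l , _) = to-injective , centre-adjacent
        where
        to-injective : to u ≢ to v
        to-injective eq = u≢v (trans (sym (strictlyInverseʳ u)) (trans (cong from eq) (strictlyInverseʳ v)))
        centre-adjacent : toℕ (to u) ≡ 0 ⊎ toℕ (to v) ≡ 0
        centre-adjacent with isIdentity? u | isIdentity? v
        ... | yes u≡1 | _       = inj₁ (Equivalence.from (centre u) u≡1)
        ... | no _    | yes v≡1 = inj₂ (Equivalence.from (centre v) v≡1)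
        ... | no u≢1  | no v≢1  =
          contradiction (trans (order-unique oᵤ (non-identity-IsOrder u u≢1))
                               (order-unique (non-identity-IsOrder v v≢1) oᵥ)) k≢l
      Star⇒OD : ∀ u v → Graph.Adj (Star _) (to u) (to v) → Graph.Adj (OD n) u v
      Star⇒OD u v (tu≢tv , inj₁ tu≡0) =
        OD-adjacent (identity-IsOrder u u≡1) (non-identity-IsOrder v v≢1) (λ ()) (1∣ 2)
        where
        u≡1 = Equivalence.to (centre u) tu≡0
        v≢1 = λ v≡1 → tu≢tv (cong to (identity-unique u≡1 v≡1))
      Star⇒OD u v (tu≢tv , inj₂ tv≡0) =
        OD-sym (OD-adjacent (identity-IsOrder v v≡1) (non-identity-IsOrder u u≢1) (λ ()) (1∣ 2))
        where
        v≡1 = Equivalence.to (centre v) tv≡0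
        u≢1 = λ u≡1 → tu≢tv (cong to (identity-unique u≡1 v≡1))

  IsUnit : Fin n → Set
  IsUnit x = gcd (toℕ x) n ≡ 1

  StarTable : ∀ {m} → (Fin m → Fin n) → (Fin n → Fin m) → Set
  StarTable units index =
      (∀ i → IsUnit (units i))
    × (∀ i → index (units i) ≡ i)
    × (∀ x → IsUnit x → units (index x) ≡ x)
    × (∀ x → IsUnit x → toℕ (index x) ≡ 0 → toℕ x ≡ 1 % n)
    × (∀ x → IsUnit x → toℕ x ≡ 1 % n → toℕ (index x) ≡ 0)
    × (∀ x → IsUnit x → toℕ x ^ 2 ≈ 1)

  starTable? : ∀ {m} (units : Fin m → Fin n) (index : Fin n → Fin m) → Dec (StarTable units index)
  starTable? units index =
        all? (λ i → isUnit? (units i))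
    ×-dec all? (λ i → index (units i) Fin.≟ i)
    ×-dec all? (λ x → isUnit? x →-dec units (index x) Fin.≟ x)
    ×-dec all? (λ x → isUnit? x →-dec toℕ (index x) ≟ 0 →-dec toℕ x ≟ 1 % n)
    ×-dec all? (λ x → isUnit? x →-dec toℕ x ≟ 1 % n →-dec toℕ (index x) ≟ 0)
    ×-dec all? (λ x → isUnit? x →-dec toℕ x ^ 2 % n ≟ 1 % n)
    where
    isUnit? : ∀ x → Dec (IsUnit x)
    isUnit? x = gcd (toℕ x) n ≟ 1

  table⇒OD≅Star : ∀ {m} {units : Fin m → Fin n} {index} → StarTable units index → OD n ≅ Star m
  table⇒OD≅Star {units = units} {index} (units-unit , index-units , units-index , index0⇒1 , 1⇒index0 , square≈1) =
    star-criterion (λ (x , x-unit) → square≈1 x x-unit) (mk↔ₛ′ to from index-units from-to)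
      (λ (x , x-unit) → mk⇔ (index0⇒1 x x-unit) (1⇒index0 x x-unit))
    where
    to : U n → Fin _
    to (x , _) = index x
    from : Fin _ → U n
    from i = units i , units-unit i
    from-to : ∀ u → from (to u) ≡ u
    from-to (x , x-unit) = Σ-≡,≡→≡ (units-index x x-unit , ≡-irrelevant _ _)

OD≅Star-by-table : ∀ n .{{_ : NonZero n}} (units : Vec (Fin n) (φ n)) (index : Vec (Fin (φ n)) n) →
            {True (StarCriterion.starTable? n (lookup units) (lookup index))} → OD n ≅ Star (φ n)
OD≅Star-by-table n units index {valid} = StarCriterion.table⇒OD≅Star n (toWitness valid)

divisors-of-24 : List ℕ
divisors-of-24 = 1 ∷ 2 ∷ 3 ∷ 4 ∷ 6 ∷ 8 ∷ 12 ∷ 24 ∷ []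

∈-divisors-of-24 : ∀ {d} → d ∣ 24 → d ∈ divisors-of-24
∈-divisors-of-24 {d} d∣24 = subst (λ e → e ∣ 24 → e ∈ divisors-of-24) (toℕ-fromℕ< d<25) (checked (fromℕ< d<25)) d∣24
  where
  d<25 : d < 25
  d<25 = s≤s (∣⇒≤ d∣24)
  checked : ∀ (i : Fin 25) → toℕ i ∣ 24 → toℕ i ∈ divisors-of-24
  checked = from-yes (all? (λ (i : Fin 25) → toℕ i ∣? 24 →-dec toℕ i ∈? divisors-of-24))

divisors-of-24-OD≅Star : All (λ d → .{{_ : NonZero d}} → OD d ≅ Star (φ d)) divisors-of-24
divisors-of-24-OD≅Star =
    OD≅Star-by-table 1 (# 0 ∷ []) (# 0 ∷ [])
  ∷ OD≅Star-by-table 2 (# 1 ∷ []) (# 0 ∷ # 0 ∷ [])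
  ∷ OD≅Star-by-table 3 (# 1 ∷ # 2 ∷ []) (# 0 ∷ # 0 ∷ # 1 ∷ [])
  ∷ OD≅Star-by-table 4 (# 1 ∷ # 3 ∷ []) (# 0 ∷ # 0 ∷ # 0 ∷ # 1 ∷ [])
  ∷ OD≅Star-by-table 6 (# 1 ∷ # 5 ∷ []) (# 0 ∷ # 0 ∷ # 0 ∷ # 0 ∷ # 0 ∷ # 1 ∷ [])
  ∷ OD≅Star-by-table 8 (# 1 ∷ # 3 ∷ # 5 ∷ # 7 ∷ []) (# 0 ∷ # 0 ∷ # 0 ∷ # 1 ∷ # 0 ∷ # 2 ∷ # 0 ∷ # 3 ∷ [])
  ∷ OD≅Star-by-table 12 (# 1 ∷ # 5 ∷ # 7 ∷ # 11 ∷ [])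
      (# 0 ∷ # 0 ∷ # 0 ∷ # 0 ∷ # 0 ∷ # 1 ∷ # 0 ∷ # 2 ∷ # 0 ∷ # 0 ∷ # 0 ∷ # 3 ∷ [])
  ∷ OD≅Star-by-table 24 (# 1 ∷ # 5 ∷ # 7 ∷ # 11 ∷ # 13 ∷ # 17 ∷ # 19 ∷ # 23 ∷ [])
      (# 0 ∷ # 0 ∷ # 0 ∷ # 0 ∷ # 0 ∷ # 1 ∷ # 0 ∷ # 2 ∷ # 0 ∷ # 0 ∷ # 0 ∷ # 3 ∷
       # 0 ∷ # 4 ∷ # 0 ∷ # 0 ∷ # 0 ∷ # 5 ∷ # 0 ∷ # 6 ∷ # 0 ∷ # 0 ∷ # 0 ∷ # 7 ∷ [])
  ∷ []

¬∣24⇒2<n : ∀ {n} → 0 < n → ¬ n ∣ 24 → 2 < n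
¬∣24⇒2<n {1} _ n∤24 = contradiction (1∣ 24) n∤24
¬∣24⇒2<n {2} _ n∤24 = contradiction (divides 12 refl) n∤24
¬∣24⇒2<n {suc (suc (suc _))} _ _ = s≤s (s≤s (s≤s z≤n))

corollary2 : (n : ℕ) → .{{_ : NonZero n}} → (OD n ≅ Star (φ n)) ⇔ (n ∣ 24)
corollary2 n = mk⇔ star⇒∣24 (λ n∣24 → All.lookup divisors-of-24-OD≅Star (∈-divisors-of-24 n∣24))
  where
  star⇒∣24 : OD n ≅ Star (φ n) → n ∣ 24
  star⇒∣24 iso with n ∣? 24
  ... | yes n∣24 = n∣24
  ... | no n∤24 with ¬∣24⇒square≉1 n∤24
  ...   | x , x⊥n , x²≉1 =
    contradiction iso (triangle⇒≇Star (Triangles.square≉1⇒triangle n (¬∣24⇒2<n (>-nonZero⁻¹ n) n∤24) x⊥n x²≉1))
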